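{- Let $(\mathscr A,\preceq,\multimap)$ be an implicative structure and $S\subseteq\mathscr A$ a linear separator. For every linear $\lambda$-term $t$ with free variables $x_1,\ldots,x_n$ and all $a_1,\ldots,a_n\in S$, we have $(t\{x_1:=a_1,\ldots,x_n:=a_n\})^{\mathscr A}\in S$. In particular $t^{\mathscr A}\in S$ for every closed linear $\lambda$-term $t$.
   Context: An implicative structure is a complete lattice $(\mathscr A,\preceq)$ with a binary operation $\multimap$ (right-associative) such that $a'\preceq a$, $b\preceq b'$ imply $(a\multimap b)\preceq(a'\multimap b')$, and $a\multimap\bigwedge_{b\in B}b=\bigwedge_{b\in B}(a\multimap b)$. Application: $ab=\bigwedge\{c\mid a\preceq(b\multimap c)\}$. Closed $\lambda$-terms with parameters in $\mathscr A$ are interpreted by $a^{\mathscr A}=a$, $(tu)^{\mathscr A}=t^{\mathscr A}u^{\mathscr A}$, $(\lambda x.t)^{\mathscr A}=\bigwedge_{a\in\mathscr A}(a\multimap(t\{x:=a\})^{\mathscr A})$. A linear $\lambda$-term is one in which every abstraction $\lambda x.u$ binds exactly one occurrence of $x$ and every free variable occurs at most once. A linear separator is a subset $S\subseteq\mathscr A$ that is upward closed, closed under modus ponens ($a\in S$, $(a\multimap b)\in S$ imply $b\in S$), and contains $\mathbf I^{\mathscr A}=\bigwedge_a(a\multimap a)$, $\mathbf B^{\mathscr A}=\bigwedge_{a,b,c}((b\multimap c)\multimap(a\multimap b)\multimap a\multimap c)$, $\mathbf C^{\mathscr A}=\bigwedge_{a,b,c}((a\multimap b\multimap c)\multimap b\multimap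 a\multimap c)$. -}

module Defs where

open import Data.Nat using (ℕ; zero; suc; _+_; _≤_)
open import Data.Fin using (Fin; zero; suc; _≟_)
open import Data.Unit using (⊤)
open import Relation.Nullary using (yes; no)
open import Data.Product using (Σ; _×_; _,_; proj₁)
open import Relation.Binary.PropositionalEquality using (_≡_)
open import Relation.Binary.Structures using (IsPartialOrder)

-- A complete lattice is presented by its meets of arbitrary families
-- (every subset B ⊆ 𝒜 is the image of the family proj₁ : Σ 𝒜 B → 𝒜);
-- arbitrary joins are then definable as meets of upper bounds.

record ImplicativeStructure : Set₁ where
  infix  4 _≼_
  infixr 6 _⇒_
  field
    Carrier : Set
    _≼_     : Carrier → Carrier → Set
    isPartialOrder : IsPartialOrder _≡_ _≼_
    ⋀       : {I : Set} → (I → Carrier) → Carrier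
    ⋀-lb    : {I : Set} (f : I → Carrier) (i : I) → ⋀ f ≼ f i
    ⋀-glb   : {I : Set} (f : I → Carrier) (c : Carrier) →
              ((i : I) → c ≼ f i) → c ≼ ⋀ f
    _⇒_     : Carrier → Carrier → Carrier
    ⇒-mono  : ∀ {a a' b b'} → a' ≼ a → b ≼ b' → (a ⇒ b) ≼ (a' ⇒ b')
    ⇒-⋀     : {I : Set} (a : Carrier) (f : I → Carrier) →
              (a ⇒ ⋀ f) ≡ ⋀ (λ i → a ⇒ f i)

  app : Carrier → Carrier → Carrier
  app a b = ⋀ {Σ Carrier (λ c → a ≼ (b ⇒ c))} proj₁

  𝐈 : Carrier
  𝐈 = ⋀ (λ a → a ⇒ a)

  𝐁 : Carrier
  𝐁 = ⋀ {Carrier × Carrier × Carrier}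
        (λ { (a , b , c) → (b ⇒ c) ⇒ (a ⇒ b) ⇒ a ⇒ c })

  𝐂 : Carrier
  𝐂 = ⋀ {Carrier × Carrier × Carrier}
        (λ { (a , b , c) → (a ⇒ b ⇒ c) ⇒ b ⇒ a ⇒ c })

record IsLinearSeparator (𝒜 : ImplicativeStructure)
         (S : ImplicativeStructure.Carrier 𝒜 → Set) : Set where
  open ImplicativeStructure 𝒜
  field
    upward : ∀ {a b} → S a → a ≼ b → S b
    mp     : ∀ {a b} → S a → S (a ⇒ b) → S b
    has-𝐈  : S 𝐈
    has-𝐁  : S 𝐁
    has-𝐂  : S 𝐂

data Λ (n : ℕ) : Set where
  var : Fin n → Λ n
  _·_ : Λ n → Λ n → Λ n
  lam : Λ (suc n) → Λ n

occ : ∀ {n} → Fin n → Λ n → ℕ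
occ i (var j) with i ≟ j
... | yes _ = 1
... | no  _ = 0
occ i (t · u) = occ i t + occ i u
occ i (lam t) = occ (suc i) t

AbsLinear : ∀ {n} → Λ n → Set
AbsLinear (var _) = ⊤
AbsLinear (t · u) = AbsLinear t × AbsLinear u
AbsLinear (lam t) = occ zero t ≡ 1 × AbsLinear t

Linear : ∀ {n} → Λ n → Set
Linear t = AbsLinear t × ((i : Fin _) → occ i t ≤ 1)

module Terms (𝒜 : ImplicativeStructure) where
  open ImplicativeStructure 𝒜

  data ΛA (n : ℕ) : Set where
    var : Fin n → ΛA n
    par : Carrier → ΛA n
    _·_ : ΛA n → ΛA n → ΛA n
    lam : ΛA (suc n) → ΛA n

  embed : ∀ {n} → Λ n → ΛA n
  embed (var i) = var i
  embed (t · u) = embed t · embed u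
  embed (lam t) = lam (embed t)

  ext : ∀ {n m} → (Fin n → Fin m) → Fin (suc n) → Fin (suc m)
  ext ρ zero    = zero
  ext ρ (suc i) = suc (ρ i)

  rename : ∀ {n m} → (Fin n → Fin m) → ΛA n → ΛA m
  rename ρ (var i) = var (ρ i)
  rename ρ (par a) = par a
  rename ρ (t · u) = rename ρ t · rename ρ u
  rename ρ (lam t) = lam (rename (ext ρ) t)

  exts : ∀ {n m} → (Fin n → ΛA m) → Fin (suc n) → ΛA (suc m)
  exts σ zero    = var zero
  exts σ (suc i) = rename suc (σ i)

  subst : ∀ {n m} → (Fin n → ΛA m) → ΛA n → ΛA m
  subst σ (var i) = σ i
  subst σ (par a) = par a
  subst σ (t · u) = subst σ t · subst σ u
  subst σ (lam t) = lam (subst (exts σ) t)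

  _[_] : ∀ {n} → ΛA n → (Fin n → Carrier) → ΛA 0
  t [ a ] = subst (λ i → par (a i)) t

  -- The interpretation of a term under an environment
  -- ρ is the interpretation of the closed term t{xᵢ := ρ i}; written this
  -- way it is structurally recursive:
  --   a^𝒜 = a,  (t u)^𝒜 = t^𝒜 u^𝒜,  (λx.t)^𝒜 = ⋀_a (a ⊸ (t{x:=a})^𝒜).
  ⟦_⟧_ : ∀ {n} → ΛA n → (Fin n → Carrier) → Carrier
  ⟦ var i ⟧ ρ = ρ i
  ⟦ par a ⟧ ρ = a
  ⟦ t · u ⟧ ρ = app (⟦ t ⟧ ρ) (⟦ u ⟧ ρ)
  ⟦ lam t ⟧ ρ = ⋀ (λ a → a ⇒ ⟦ t ⟧ (cons a ρ))
    where
    cons : ∀ {k} → Carrier → (Fin k → Carrier) → Fin (suc k) → Carrier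
    cons a ρ zero    = a
    cons a ρ (suc i) = ρ i

  ⟦_⟧ᶜ : ΛA 0 → Carrier
  ⟦ t ⟧ᶜ = ⟦ t ⟧ (λ ())

-- Bracket abstraction with the combinators B, C and I compiles every
-- λ-term whose abstractions are linear into a combinatory term over B, C, I
-- and the free variables.  In an implicative structure the compiled term is
-- interpreted below the λ-term: application is the left adjoint
-- (a b ≼ c iff a ≼ b ⊸ c), so the usual reductions of B, C, I hold as
-- inequalities.  A linear separator contains B, C, I and is closed under
-- application (from a ≼ b ⊸ a b and modus ponens), hence contains the
-- compiled term, and by upward closure the λ-term.
module Submission where

open import Defs
open import Data.Nat using (ℕ; zero; suc; _+_; _≤_)
open import Data.Nat.Properties using (suc-injective)
open import Data.Fin using (Fin; zero; suc)
open import Data.Fin.Properties using (_≟_)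
open import Data.Product using (_×_; _,_; proj₁; proj₂)
open import Relation.Nullary using (yes; no)
open import Relation.Binary.PropositionalEquality
  using (_≡_; refl; sym; trans; cong; cong₂; subst)
open import Relation.Binary.Structures using (IsPartialOrder)

module ImplicativeProperties (𝒜 : ImplicativeStructure) where
  open ImplicativeStructure 𝒜
  open IsPartialOrder isPartialOrder public
    using () renaming (refl to ≼-refl; trans to ≼-trans; antisym to ≼-antisym)

  ⋀-cong : {I : Set} {f g : I → Carrier} → (∀ i → f i ≡ g i) → ⋀ f ≡ ⋀ g
  ⋀-cong {f = f} {g} f≗g = ≼-antisym
    (⋀-glb g (⋀ f) (λ i → subst (⋀ f ≼_) (f≗g i) (⋀-lb f i)))
    (⋀-glb f (⋀ g) (λ i → subst (⋀ g ≼_) (sym (f≗g i)) (⋀-lb g i)))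

  app-≼ : ∀ {a b c} → a ≼ (b ⇒ c) → app a b ≼ c
  app-≼ {c = c} a≼b⇒c = ⋀-lb proj₁ (c , a≼b⇒c)

  ≼-⇒-app : ∀ a b → a ≼ (b ⇒ app a b)
  ≼-⇒-app a b = subst (a ≼_) (sym (⇒-⋀ b proj₁)) (⋀-glb _ a proj₂)

  app-mono : ∀ {a a' b b'} → a ≼ a' → b ≼ b' → app a b ≼ app a' b'
  app-mono {a} a≼a' b≼b' = ⋀-glb proj₁ (app a _) λ where
    (c , a'≼b'⇒c) → app-≼ (≼-trans a≼a' (≼-trans a'≼b'⇒c (⇒-mono b≼b' ≼-refl)))

  𝐈-≼ : ∀ a → 𝐈 ≼ (a ⇒ a)
  𝐈-≼ = ⋀-lb (λ a → a ⇒ a)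

  𝐁-app-≼ : ∀ {a u v l} → l ≼ (a ⇒ v) → app (app 𝐁 u) l ≼ (a ⇒ app u v)
  𝐁-app-≼ {a} {u} {v} l≼a⇒v = app-≼ (app-≼ (≼-trans
    (⋀-lb _ (a , v , app u v))
    (⇒-mono (≼-⇒-app u v) (⇒-mono l≼a⇒v ≼-refl))))

  𝐂-app-≼ : ∀ {a u v l} → l ≼ (a ⇒ u) → app (app 𝐂 l) v ≼ (a ⇒ app u v)
  𝐂-app-≼ {a} {u} {v} l≼a⇒u = app-≼ (app-≼ (≼-trans
    (⋀-lb _ (a , v , app u v))
    (⇒-mono (≼-trans l≼a⇒u (⇒-mono ≼-refl (≼-⇒-app u v))) ≼-refl)))

module LinearSeparatorProperties
  {𝒜 : ImplicativeStructure} {S : ImplicativeStructure.Carrier 𝒜 → Set}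
  (sep : IsLinearSeparator 𝒜 S) where
  open ImplicativeStructure 𝒜
  open ImplicativeProperties 𝒜
  open IsLinearSeparator sep

  app-∈ : ∀ {a b} → S a → S b → S (app a b)
  app-∈ {a} {b} a∈S b∈S = mp b∈S (upward a∈S (≼-⇒-app a b))

module Semantics (𝒜 : ImplicativeStructure) where
  open ImplicativeStructure 𝒜
  open ImplicativeProperties 𝒜
  open Terms 𝒜 hiding (subst)
  module T = Terms 𝒜

  infixr 5 _∷_

  _∷_ : ∀ {n} → Carrier → (Fin n → Carrier) → Fin (suc n) → Carrier
  (a ∷ ρ) zero    = a
  (a ∷ ρ) (suc i) = ρ i

  ⟦⟧-cong : ∀ {n} (t : ΛA n) {ρ ρ' : Fin n → Carrier} →
            (∀ i → ρ i ≡ ρ' i) → ⟦ t ⟧ ρ ≡ ⟦ t ⟧ ρ'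
  ⟦⟧-cong (var i) ρ≗ρ' = ρ≗ρ' i
  ⟦⟧-cong (par a) ρ≗ρ' = refl
  ⟦⟧-cong (t · u) ρ≗ρ' = cong₂ app (⟦⟧-cong t ρ≗ρ') (⟦⟧-cong u ρ≗ρ')
  ⟦⟧-cong (lam t) ρ≗ρ' = ⋀-cong λ a → cong (a ⇒_) (⟦⟧-cong t λ where
    zero    → refl
    (suc i) → ρ≗ρ' i)

  -- The interpretation of lam extends the environment with a function local
  -- to Defs; this restates the clause with _∷_.
  ⟦lam⟧ : ∀ {n} (t : ΛA (suc n)) (ρ : Fin n → Carrier) →
          ⟦ lam t ⟧ ρ ≡ ⋀ (λ a → a ⇒ ⟦ t ⟧ (a ∷ ρ))
  ⟦lam⟧ t ρ = ⋀-cong λ a → cong (a ⇒_) (⟦⟧-cong t λ where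
    zero    → refl
    (suc i) → refl)

  ⟦rename⟧ : ∀ {n m} (r : Fin n → Fin m) (t : ΛA n) (ρ : Fin m → Carrier) →
             ⟦ rename r t ⟧ ρ ≡ ⟦ t ⟧ (λ i → ρ (r i))
  ⟦rename⟧ r (var i) ρ = refl
  ⟦rename⟧ r (par a) ρ = refl
  ⟦rename⟧ r (t · u) ρ = cong₂ app (⟦rename⟧ r t ρ) (⟦rename⟧ r u ρ)
  ⟦rename⟧ r (lam t) ρ = ⋀-cong λ a → cong (a ⇒_)
    (trans (⟦rename⟧ (ext r) t _) (⟦⟧-cong t λ where
      zero    → refl
      (suc i) → refl))

  ⟦subst⟧ : ∀ {n m} (σ : Fin n → ΛA m) (t : ΛA n) (ρ : Fin m → Carrier) →
            ⟦ T.subst σ t ⟧ ρ ≡ ⟦ t ⟧ (λ i → ⟦ σ i ⟧ ρ)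
  ⟦subst⟧ σ (var i) ρ = refl
  ⟦subst⟧ σ (par a) ρ = refl
  ⟦subst⟧ σ (t · u) ρ = cong₂ app (⟦subst⟧ σ t ρ) (⟦subst⟧ σ u ρ)
  ⟦subst⟧ σ (lam t) ρ = ⋀-cong λ a → cong (a ⇒_)
    (trans (⟦subst⟧ (exts σ) t _) (⟦⟧-cong t λ where
      zero    → refl
      (suc i) → ⟦rename⟧ suc (σ i) _))

  ⟦[]⟧ : ∀ {n} (t : ΛA n) (a : Fin n → Carrier) → ⟦ t [ a ] ⟧ᶜ ≡ ⟦ t ⟧ a
  ⟦[]⟧ t a = ⟦subst⟧ (λ i → par (a i)) t (λ ())

data BCI (n : ℕ) : Set where
  var     : Fin n → BCI n
  I B C   : BCI n
  _·_     : BCI n → BCI n → BCI n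

occᶜ : ∀ {n} → Fin n → BCI n → ℕ
occᶜ i (var j) = occ i (var j)
occᶜ i I       = 0
occᶜ i B       = 0
occᶜ i C       = 0
occᶜ i (c · d) = occᶜ i c + occᶜ i d

-- Shifts the variables down; the variable zero, which it is only applied to
-- terms without, is sent to the junk value I.
strengthen : ∀ {n} → BCI (suc n) → BCI n
strengthen (var zero)    = I
strengthen (var (suc j)) = var j
strengthen I             = I
strengthen B             = B
strengthen C             = C
strengthen (c · d)       = strengthen c · strengthen d

-- λx.(c d) is B c (λx.d) when x occurs in d and C (λx.c) d otherwise;
-- meaningful only when x occurs exactly once.
bracket : ∀ {n} → BCI (suc n) → BCI n
bracket (c · d) with occᶜ zero c
... | zero  = (B · strengthen c) · bracket d
... | suc _ = (C · bracket c) · strengthen d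
bracket c = strengthen c

compile : ∀ {n} → Λ n → BCI n
compile (var i) = var i
compile (t · u) = compile t · compile u
compile (lam t) = bracket (compile t)

occ-var-suc : ∀ {n} (i j : Fin n) → occ (suc i) (var (suc j)) ≡ occ i (var j)
occ-var-suc i j with i ≟ j
... | yes _ = refl
... | no  _ = refl

occᶜ-strengthen : ∀ {n} (c : BCI (suc n)) (i : Fin n) →
                  occᶜ i (strengthen c) ≡ occᶜ (suc i) c
occᶜ-strengthen (var zero)    i = refl
occᶜ-strengthen (var (suc j)) i = sym (occ-var-suc i j)
occᶜ-strengthen I             i = refl
occᶜ-strengthen B             i = refl
occᶜ-strengthen C             i = refl
occᶜ-strengthen (c · d)       i =
  cong₂ _+_ (occᶜ-strengthen c i) (occᶜ-strengthen d i)

occᶜ-bracket : ∀ {n} (c : BCI (suc n)) → occᶜ zero c ≡ 1 →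
               (i : Fin n) → occᶜ i (bracket c) ≡ occᶜ (suc i) c
occᶜ-bracket (var zero) _ i = refl
occᶜ-bracket (c · d) once i with occᶜ zero c in occ-c
... | zero = cong₂ _+_ (occᶜ-strengthen c i) (occᶜ-bracket d once i)
... | suc zero = cong₂ _+_ (occᶜ-bracket c occ-c i) (occᶜ-strengthen d i)

occᶜ-compile : ∀ {n} (t : Λ n) → AbsLinear t → (i : Fin n) →
               occᶜ i (compile t) ≡ occ i t
occᶜ-compile (var j) _ i = refl
occᶜ-compile (t · u) (lin-t , lin-u) i =
  cong₂ _+_ (occᶜ-compile t lin-t i) (occᶜ-compile u lin-u i)
occᶜ-compile (lam t) (once , lin-t) i =
  trans (occᶜ-bracket (compile t) (trans (occᶜ-compile t lin-t zero) once) i)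
        (occᶜ-compile t lin-t (suc i))

module BCISemantics (𝒜 : ImplicativeStructure) where
  open ImplicativeStructure 𝒜
  open ImplicativeProperties 𝒜
  open Semantics 𝒜
  open Terms 𝒜 using (⟦_⟧_; embed)

  ⟪_⟫_ : ∀ {n} → BCI n → (Fin n → Carrier) → Carrier
  ⟪ var i ⟫ ρ = ρ i
  ⟪ I ⟫     ρ = 𝐈
  ⟪ B ⟫     ρ = 𝐁
  ⟪ C ⟫     ρ = 𝐂
  ⟪ c · d ⟫ ρ = app (⟪ c ⟫ ρ) (⟪ d ⟫ ρ)

  ⟪strengthen⟫ : ∀ {n} (c : BCI (suc n)) → occᶜ zero c ≡ 0 →
                 ∀ ρ a → ⟪ strengthen c ⟫ ρ ≡ ⟪ c ⟫ (a ∷ ρ)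
  ⟪strengthen⟫ (var (suc j)) _ ρ a = refl
  ⟪strengthen⟫ I             _ ρ a = refl
  ⟪strengthen⟫ B             _ ρ a = refl
  ⟪strengthen⟫ C             _ ρ a = refl
  ⟪strengthen⟫ (c · d) absent ρ a with occᶜ zero c in occ-c
  ... | zero = cong₂ app (⟪strengthen⟫ c occ-c ρ a) (⟪strengthen⟫ d absent ρ a)

  ⟪bracket⟫-≼ : ∀ {n} (c : BCI (suc n)) → occᶜ zero c ≡ 1 →
                ∀ ρ a → ⟪ bracket c ⟫ ρ ≼ (a ⇒ ⟪ c ⟫ (a ∷ ρ))
  ⟪bracket⟫-≼ (var zero) _ ρ a = 𝐈-≼ a
  ⟪bracket⟫-≼ (c · d) once ρ a with occᶜ zero c in occ-c
  ... | zero rewrite ⟪strengthen⟫ c occ-c ρ a =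
    𝐁-app-≼ (⟪bracket⟫-≼ d once ρ a)
  ... | suc zero rewrite ⟪strengthen⟫ d (suc-injective once) ρ a =
    𝐂-app-≼ (⟪bracket⟫-≼ c occ-c ρ a)

  ⟪compile⟫-≼ : ∀ {n} (t : Λ n) → AbsLinear t →
                ∀ ρ → ⟪ compile t ⟫ ρ ≼ ⟦ embed t ⟧ ρ
  ⟪compile⟫-≼ (var i) _ ρ = ≼-refl
  ⟪compile⟫-≼ (t · u) (lin-t , lin-u) ρ =
    app-mono (⟪compile⟫-≼ t lin-t ρ) (⟪compile⟫-≼ u lin-u ρ)
  ⟪compile⟫-≼ (lam t) (once , lin-t) ρ =
    subst (⟪ bracket (compile t) ⟫ ρ ≼_) (sym (⟦lam⟧ (embed t) ρ)) (⋀-glb _ _ λ a → ≼-trans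
      (⟪bracket⟫-≼ (compile t) (trans (occᶜ-compile t lin-t zero) once) ρ a)
      (⇒-mono ≼-refl (⟪compile⟫-≼ t lin-t (a ∷ ρ))))

module Soundness
  {𝒜 : ImplicativeStructure} {S : ImplicativeStructure.Carrier 𝒜 → Set}
  (sep : IsLinearSeparator 𝒜 S) where
  open ImplicativeStructure 𝒜 using (Carrier)
  open IsLinearSeparator sep
  open LinearSeparatorProperties sep
  open BCISemantics 𝒜
  open Terms 𝒜 using (⟦_⟧_; embed)

  ⟪⟫-∈ : ∀ {n} (c : BCI n) {ρ} → (∀ i → S (ρ i)) → S (⟪ c ⟫ ρ)
  ⟪⟫-∈ (var i) ρ∈S = ρ∈S i
  ⟪⟫-∈ I       ρ∈S = has-𝐈
  ⟪⟫-∈ B       ρ∈S = has-𝐁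
  ⟪⟫-∈ C       ρ∈S = has-𝐂
  ⟪⟫-∈ (c · d) ρ∈S = app-∈ (⟪⟫-∈ c ρ∈S) (⟪⟫-∈ d ρ∈S)

  ⟦embed⟧-∈ : ∀ {n} (t : Λ n) → AbsLinear t →
              {ρ : Fin n → Carrier} → (∀ i → S (ρ i)) → S (⟦ embed t ⟧ ρ)
  ⟦embed⟧-∈ t lin {ρ} ρ∈S = upward (⟪⟫-∈ (compile t) ρ∈S) (⟪compile⟫-≼ t lin ρ)

proposition3p6 :
    (𝒜 : ImplicativeStructure) →
    (S : ImplicativeStructure.Carrier 𝒜 → Set) →
    IsLinearSeparator 𝒜 S →
    ((n : ℕ) (t : Λ n) → Linear t → ((i : Fin n) → 1 ≤ occ i t) →
      (a : Fin n → ImplicativeStructure.Carrier 𝒜) → ((i : Fin n) → S (a i)) →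
      S (Terms.⟦_⟧ᶜ 𝒜 (Terms._[_] 𝒜 (Terms.embed 𝒜 t) a)))
    ×
    ((t : Λ 0) → Linear t → S (Terms.⟦_⟧ᶜ 𝒜 (Terms.embed 𝒜 t)))
proposition3p6 𝒜 S sep =
  (λ n t (lin , _) _ a a∈S →
     subst S (sym (⟦[]⟧ (embed t) a)) (⟦embed⟧-∈ t lin a∈S)) ,
  (λ t (lin , _) → ⟦embed⟧-∈ t lin (λ ()))
  where
  open Terms 𝒜 using (embed)
  open Semantics 𝒜 using (⟦[]⟧)
  open Soundness sep using (⟦embed⟧-∈)
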